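{- Let $G=(e_X,e_Y,R)$ be a Galois polarity extending the poset $P$. Then: (1) the maps $\iota_X:X\to X\uplus_{\preceq_3}Y$ and $\iota_Y:Y\to X\uplus_{\preceq_3}Y$ are completely meet-preserving and completely join-preserving, respectively; (2) $\preceq_3$ is the only 3-preorder for $G$; (3) $X\uplus_{\preceq_3}Y$ is join-generated by $\iota_X[X]$ and meet-generated by $\iota_Y[Y]$.
   Context: For a poset $Q$ and $q\in Q$, $q^\uparrow=\{r\in Q:r\ge q\}$, $q^\downarrow=\{r\in Q:r\le q\}$. An order embedding $e:P\to Q$ is a meet-extension if $q=\bigwedge e[e^{ -1}(q^\uparrow)]$ for all $q\in Q$, and a join-extension if $q=\bigvee e[e^{ -1}(q^\downarrow)]$ for all $q\in Q$. An extension polarity is a triple $(e_X,e_Y,R)$ where $P$ is a poset, $X,Y$ disjoint posets, $e_X:P\to X$, $e_Y:P\to Y$ order embeddings, $R\subseteq X\times Y$. It is 3-coherent if: (C1) $x_1\le_X x_2$ and $x_2\mathrel{R}y$ imply $x_1\mathrel{R}y$; (C2) $y_1\le_Y y_2$ and $x\mathrel{R}y_1$ imply $x\mathrel{R}y_2$; (C3) $e_X(p)\mathrel{R}e_Y(p)$ for all $p\in P$; (C4) $x\mathrel{R}e_Y(p)$ and $e_X(p)\mathrel{R}y$ imply $x\mathrel{R}y$; (C5) $x_1\mathrel{R}e_Y(p)$ and $e_X(p)\le_X x_2$ imply $x_1\le_X x_2$; (C6) $y_1\le_Y e_Y(p)$ and $e_X(p)\mathrel{R}y_2$ imply $y_1\le_Y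 y_2$; (C7) if $S\subseteq P$, $\bigwedge e_X[S]=x$ in $X$, $x\mathrel{R}y_2$ and $y_1\le_Y e_Y(p)$ for all $p\in S$, then $y_1\le_Y y_2$; (C8) if $T\subseteq P$, $\bigvee e_Y[T]=y$ in $Y$, $x_1\mathrel{R}y$ and $e_X(q)\le_X x_2$ for all $q\in T$, then $x_1\le_X x_2$. A Galois polarity is a 3-coherent extension polarity in which $e_X$ is a meet-extension and $e_Y$ is a join-extension. For a preorder $\preceq$ on $X\cup Y$, $X\uplus_\preceq Y$ is the quotient poset (identify $z_1,z_2$ when $z_1\preceq z_2\preceq z_1$) and $\iota_X,\iota_Y$ are the inclusions composed with the quotient map. A 3-preorder for the polarity is a preorder $\preceq$ on $X\cup Y$ such that: $x\preceq y\iff x\mathrel{R}y$ for $x\in X,y\in Y$; ${\le_X}\subseteq{\preceq}$, ${\le_Y}\subseteq{\preceq}$; $\iota_X\circ e_X=\iota_Y\circ e_Y$; $\iota_X,\iota_Y$ are order embeddings; for all $S\subseteq P$ such that $\bigwedge e_X[S]$ exists in $X$, $\iota_X(\bigwedge e_X[S])=\bigwedge\iota_X\circ e_X[S]$ in $X\uplus_\preceq Y$; and for all $T\subseteq P$ such that $\bigvee e_Y[T]$ exists in $Y$, $\iota_Y(\bigvee e_Y[T])=\bigvee\iota_Y\circ e_Y[T]$ in $X\uplus_\preceq Y$. $\preceq_3$ is the union of ${\le_X}\cup{\le_Y}\cup R$ with $Z_S=\{(y,x)\in Y\times X:\exists S\subseteq P\,(\bigwedge e_X[S]\text{ exists in }X,\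 \bigwedge e_X[S]\le_X x,\ y\le_Y e_Y(p)\ \forall p\in S)\}$ and $Z_T=\{(y,x)\in Y\times X:\exists T\subseteq P\,(\bigvee e_Y[T]\text{ exists in }Y,\ y\le_Y \bigvee e_Y[T],\ e_X(q)\le_X x\ \forall q\in T)\}$. -}

module Defs where

open import Level using (Level; 0ℓ; _⊔_) renaming (suc to lsuc)
open import Data.Product using (Σ; ∃; ∃-syntax; _×_; _,_)
open import Data.Sum using (_⊎_; inj₁; inj₂)
open import Function.Bundles using (_⇔_)
open import Relation.Unary using (Pred)
open import Relation.Binary.Bundles using (Poset)

module _ {a i ℓ ℓ' : Level} {A : Set a} {I : Set i} where

  Meet : (A → A → Set ℓ) → Pred I ℓ' → (I → A) → A → Set (a ⊔ i ⊔ ℓ ⊔ ℓ')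
  Meet _≤_ S f m =
    (∀ j → S j → m ≤ f j) × (∀ l → (∀ j → S j → l ≤ f j) → l ≤ m)

  Join : (A → A → Set ℓ) → Pred I ℓ' → (I → A) → A → Set (a ⊔ i ⊔ ℓ ⊔ ℓ')
  Join _≤_ S f m =
    (∀ j → S j → f j ≤ m) × (∀ u → (∀ j → S j → f j ≤ u) → m ≤ u)

record ExtensionPolarity : Set₁ where
  field
    P X Y : Poset 0ℓ 0ℓ 0ℓ
  module P = Poset P
  module X = Poset X
  module Y = Poset Y
  field
    eX : P.Carrier → X.Carrier
    eY : P.Carrier → Y.Carrier
    eX-emb : ∀ p q → (p P.≤ q ⇔ eX p X.≤ eX q)
    eY-emb : ∀ p q → (p P.≤ q ⇔ eY p Y.≤ eY q)
    R : X.Carrier → Y.Carrier → Set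

module _ (G : ExtensionPolarity) where
  open ExtensionPolarity G

  IsMeetExtension-eX : Set
  IsMeetExtension-eX = ∀ x → Meet X._≤_ (λ p → x X.≤ eX p) eX x

  IsJoinExtension-eY : Set
  IsJoinExtension-eY = ∀ y → Join Y._≤_ (λ p → eY p Y.≤ y) eY y

  record Is3Coherent : Set₁ where
    field
      C1 : ∀ {x₁ x₂ y} → x₁ X.≤ x₂ → R x₂ y → R x₁ y
      C2 : ∀ {y₁ y₂ x} → y₁ Y.≤ y₂ → R x y₁ → R x y₂
      C3 : ∀ p → R (eX p) (eY p)
      C4 : ∀ {x y p} → R x (eY p) → R (eX p) y → R x y
      C5 : ∀ {x₁ x₂ p} → R x₁ (eY p) → eX p X.≤ x₂ → x₁ X.≤ x₂
      C6 : ∀ {y₁ y₂ p} → y₁ Y.≤ eY p → R (eX p) y₂ → y₁ Y.≤ y₂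
      C7 : ∀ (S : Pred P.Carrier 0ℓ) x y₁ y₂ → Meet X._≤_ S eX x → R x y₂ →
           (∀ p → S p → y₁ Y.≤ eY p) → y₁ Y.≤ y₂
      C8 : ∀ (T : Pred P.Carrier 0ℓ) y x₁ x₂ → Join Y._≤_ T eY y → R x₁ y →
           (∀ q → T q → eX q X.≤ x₂) → x₁ X.≤ x₂

  record IsGaloisPolarity : Set₁ where
    field
      coherent : Is3Coherent
      meetExt  : IsMeetExtension-eX
      joinExt  : IsJoinExtension-eY

  -- The carrier X ∪ Y (X and Y are disjoint, so this is the disjoint union).
  Z : Set
  Z = X.Carrier ⊎ Y.Carrier

  ιX : X.Carrier → Z
  ιX = inj₁

  ιY : Y.Carrier → Z
  ιY = inj₂

  -- 3-preorders.  The quotient X ⊎_≼ Y has as order the one induced by ≼,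
  -- so meets/joins and equalities in the quotient are glbs/lubs and
  -- mutual ≼-relatedness of representatives.
  record Is3Preorder {ℓ : Level} (_≼_ : Z → Z → Set ℓ) : Set (ℓ ⊔ Level.suc 0ℓ) where
    field
      refl≼  : ∀ z → z ≼ z
      trans≼ : ∀ {z₁ z₂ z₃} → z₁ ≼ z₂ → z₂ ≼ z₃ → z₁ ≼ z₃
      R⇔     : ∀ x y → (ιX x ≼ ιY y ⇔ R x y)
      ≤X⊆    : ∀ {x₁ x₂} → x₁ X.≤ x₂ → ιX x₁ ≼ ιX x₂
      ≤Y⊆    : ∀ {y₁ y₂} → y₁ Y.≤ y₂ → ιY y₁ ≼ ιY y₂
      e-eq₁  : ∀ p → ιX (eX p) ≼ ιY (eY p)
      e-eq₂  : ∀ p → ιY (eY p) ≼ ιX (eX p)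
      ιX-emb : ∀ x₁ x₂ → ιX x₁ ≼ ιX x₂ → x₁ X.≤ x₂
      ιY-emb : ∀ y₁ y₂ → ιY y₁ ≼ ιY y₂ → y₁ Y.≤ y₂
      meets  : ∀ (S : Pred P.Carrier 0ℓ) m → Meet X._≤_ S eX m →
               Meet _≼_ S (λ p → ιX (eX p)) (ιX m)
      joins  : ∀ (T : Pred P.Carrier 0ℓ) m → Join Y._≤_ T eY m →
               Join _≼_ T (λ p → ιY (eY p)) (ιY m)

  ZS : Y.Carrier → X.Carrier → Set₁
  ZS y x = ∃[ S ] ∃[ m ] (Meet X._≤_ S eX m × m X.≤ x × (∀ p → S p → y Y.≤ eY p))

  ZT : Y.Carrier → X.Carrier → Set₁
  ZT y x = ∃[ T ] ∃[ m ] (Join Y._≤_ T eY m × y Y.≤ m × (∀ q → T q → eX q X.≤ x))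

  _≼₃_ : Z → Z → Set₁
  inj₁ x₁ ≼₃ inj₁ x₂ = Level.Lift _ (x₁ X.≤ x₂)
  inj₂ y₁ ≼₃ inj₂ y₂ = Level.Lift _ (y₁ Y.≤ y₂)
  inj₁ x  ≼₃ inj₂ y  = Level.Lift _ (R x y)
  inj₂ y  ≼₃ inj₁ x  = ZS y x ⊎ ZT y x

module Submission where

open import Defs
open import Level using (0ℓ; lift; lower)
open import Data.Product using (Σ; _×_; _,_; proj₂)
open import Data.Sum using (inj₁; inj₂; [_,_])
open import Function.Base using (id; _∘_)
open import Function.Bundles using (_⇔_; mk⇔; Equivalence)
open import Function.Construct.Composition using (_⇔-∘_)
open import Function.Construct.Symmetry using (⇔-sym)
open import Relation.Unary using (Pred)

-- The X–Y block of ≼₃ is the whole difficulty.  In a Galois polarity every x is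
-- the meet of the eX p above it and every y the join of the eY q below it, so
-- y ≼₃ x can only mean "x ≤ eX p implies y ≤ eY p" (equivalently "eY q ≤ y implies
-- eX q ≤ x"); the coherence axioms show that Z_S and Z_T say exactly this.  With
-- that description transitivity, preservation of meets and joins, uniqueness and
-- density all reduce to the extension properties of eX and eY.

module GaloisPolarity (G : ExtensionPolarity) (gal : IsGaloisPolarity G) where
  open ExtensionPolarity G
  open IsGaloisPolarity gal
  open Is3Coherent coherent

  infix 4 _≼_
  _≼_ : Z G → Z G → Set₁
  _≼_ = _≼₃_ G

  eX≤⇒eY≤ : ∀ {p q} → eX p X.≤ eX q → eY p Y.≤ eY q
  eX≤⇒eY≤ {p} {q} = Equivalence.to (eY-emb p q) ∘ Equivalence.from (eX-emb p q)

  eY≤⇒eX≤ : ∀ {p q} → eY p Y.≤ eY q → eX p X.≤ eX q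
  eY≤⇒eX≤ {p} {q} = Equivalence.to (eX-emb p q) ∘ Equivalence.from (eY-emb p q)

  _≼ˢ_ : Y.Carrier → X.Carrier → Set
  y ≼ˢ x = ∀ p → x X.≤ eX p → y Y.≤ eY p

  _≼ᵗ_ : Y.Carrier → X.Carrier → Set
  y ≼ᵗ x = ∀ q → eY q Y.≤ y → eX q X.≤ x

  ≼ˢ⇒≼ᵗ : ∀ {y x} → y ≼ˢ x → y ≼ᵗ x
  ≼ˢ⇒≼ᵗ {y} {x} y≼x q eYq≤y =
    proj₂ (meetExt x) (eX q) (λ p x≤eXp → eY≤⇒eX≤ (Y.trans eYq≤y (y≼x p x≤eXp)))

  ZS⇒≼ˢ : ∀ {y x} → ZS G y x → y ≼ˢ x
  ZS⇒≼ˢ {y} (S , m , m≡⋀S , m≤x , y≤S) p x≤eXp =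
    C7 S m y (eY p) m≡⋀S (C1 (X.trans m≤x x≤eXp) (C3 p)) y≤S

  ZT⇒≼ˢ : ∀ {y x} → ZT G y x → y ≼ˢ x
  ZT⇒≼ˢ (T , m , (_ , least) , y≤m , T≤x) p x≤eXp =
    Y.trans y≤m (least (eY p) (λ q Tq → eX≤⇒eY≤ (X.trans (T≤x q Tq) x≤eXp)))

  ≼₃⇒≼ˢ : ∀ {y x} → inj₂ y ≼ inj₁ x → y ≼ˢ x
  ≼₃⇒≼ˢ = [ ZS⇒≼ˢ , ZT⇒≼ˢ ]

  ≼₃⇒≼ᵗ : ∀ {y x} → inj₂ y ≼ inj₁ x → y ≼ᵗ x
  ≼₃⇒≼ᵗ = ≼ˢ⇒≼ᵗ ∘ ≼₃⇒≼ˢ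

  ≼ˢ⇒≼₃ : ∀ {y x} → y ≼ˢ x → inj₂ y ≼ inj₁ x
  ≼ˢ⇒≼₃ {x = x} y≼x = inj₁ ((λ p → x X.≤ eX p) , x , meetExt x , X.refl , y≼x)

  ≼ᵗ⇒≼₃ : ∀ {y x} → y ≼ᵗ x → inj₂ y ≼ inj₁ x
  ≼ᵗ⇒≼₃ {y} y≼x = inj₂ ((λ q → eY q Y.≤ y) , y , joinExt y , Y.refl , y≼x)

  R-≼ˢ⇒≤ : ∀ {x y x′} → R x y → y ≼ˢ x′ → x X.≤ x′
  R-≼ˢ⇒≤ {x} {x′ = x′} xRy y≼x′ =
    proj₂ (meetExt x′) x (λ p x′≤eXp → C5 (C2 (y≼x′ p x′≤eXp) xRy) X.refl)

  ≼ᵗ-R⇒≤ : ∀ {y x y′} → y ≼ᵗ x → R x y′ → y Y.≤ y′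
  ≼ᵗ-R⇒≤ {y} {y′ = y′} y≼x xRy′ =
    proj₂ (joinExt y) y′ (λ q eYq≤y → C6 Y.refl (C1 (y≼x q eYq≤y) xRy′))

  ≼-refl : ∀ z → z ≼ z
  ≼-refl (inj₁ x) = lift X.refl
  ≼-refl (inj₂ y) = lift Y.refl

  ≼-trans : ∀ {z₁ z₂ z₃} → z₁ ≼ z₂ → z₂ ≼ z₃ → z₁ ≼ z₃
  ≼-trans {inj₁ _} {inj₁ _} {inj₁ _} (lift x≤x′) (lift x′≤x″) = lift (X.trans x≤x′ x′≤x″)
  ≼-trans {inj₁ _} {inj₁ _} {inj₂ _} (lift x≤x′) (lift x′Ry)  = lift (C1 x≤x′ x′Ry)
  ≼-trans {inj₁ _} {inj₂ _} {inj₁ _} (lift xRy)  y≼x′         = lift (R-≼ˢ⇒≤ xRy (≼₃⇒≼ˢ y≼x′))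
  ≼-trans {inj₁ _} {inj₂ _} {inj₂ _} (lift xRy)  (lift y≤y′)  = lift (C2 y≤y′ xRy)
  ≼-trans {inj₂ _} {inj₁ _} {inj₁ _} y≼x         (lift x≤x′)  =
    ≼ˢ⇒≼₃ (λ p x′≤eXp → ≼₃⇒≼ˢ y≼x p (X.trans x≤x′ x′≤eXp))
  ≼-trans {inj₂ _} {inj₁ _} {inj₂ _} y≼x         (lift xRy′)  = lift (≼ᵗ-R⇒≤ (≼₃⇒≼ᵗ y≼x) xRy′)
  ≼-trans {inj₂ _} {inj₂ _} {inj₁ _} (lift y≤y′) y′≼x         =
    ≼ˢ⇒≼₃ (λ p x≤eXp → Y.trans y≤y′ (≼₃⇒≼ˢ y′≼x p x≤eXp))
  ≼-trans {inj₂ _} {inj₂ _} {inj₂ _} (lift y≤y′) (lift y′≤y″) = lift (Y.trans y≤y′ y′≤y″)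

  eY≼eX : ∀ p → inj₂ (eY p) ≼ inj₁ (eX p)
  eY≼eX p = ≼ˢ⇒≼₃ (λ q eXp≤eXq → eX≤⇒eY≤ eXp≤eXq)

  ιX-preserves-meets : ∀ {I : Set} (S : Pred I 0ℓ) (f : I → X.Carrier) m →
                       Meet X._≤_ S f m → Meet _≼_ S (inj₁ ∘ f) (inj₁ m)
  ιX-preserves-meets S f m (lower-bound , greatest) = (λ j Sj → lift (lower-bound j Sj)) , greatest′
    where
    greatest′ : ∀ l → (∀ j → S j → l ≼ inj₁ (f j)) → l ≼ inj₁ m
    greatest′ (inj₁ x) x≼S = lift (greatest x (λ j Sj → lower (x≼S j Sj)))
    greatest′ (inj₂ y) y≼S = ≼ᵗ⇒≼₃ (λ q eYq≤y → greatest (eX q) (λ j Sj → ≼₃⇒≼ᵗ (y≼S j Sj) q eYq≤y))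

  ιY-preserves-joins : ∀ {I : Set} (T : Pred I 0ℓ) (f : I → Y.Carrier) m →
                       Join Y._≤_ T f m → Join _≼_ T (inj₂ ∘ f) (inj₂ m)
  ιY-preserves-joins T f m (upper-bound , least) = (λ j Tj → lift (upper-bound j Tj)) , least′
    where
    least′ : ∀ u → (∀ j → T j → inj₂ (f j) ≼ u) → inj₂ m ≼ u
    least′ (inj₂ y) T≼y = lift (least y (λ j Tj → lower (T≼y j Tj)))
    least′ (inj₁ x) T≼x = ≼ˢ⇒≼₃ (λ p x≤eXp → least (eY p) (λ j Tj → ≼₃⇒≼ˢ (T≼x j Tj) p x≤eXp))

  ≼-is3Preorder : Is3Preorder G _≼_
  ≼-is3Preorder = record
    { refl≼  = ≼-refl
    ; trans≼ = λ {z₁} {z₂} {z₃} → ≼-trans {z₁} {z₂} {z₃}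
    ; R⇔     = λ _ _ → mk⇔ lower lift
    ; ≤X⊆    = lift
    ; ≤Y⊆    = lift
    ; e-eq₁  = lift ∘ C3
    ; e-eq₂  = eY≼eX
    ; ιX-emb = λ _ _ → lower
    ; ιY-emb = λ _ _ → lower
    ; meets  = λ S → ιX-preserves-meets S eX
    ; joins  = λ T → ιY-preserves-joins T eY
    }

  module _ {_⊑_ : Z G → Z G → Set₁} (⊑-is3Preorder : Is3Preorder G _⊑_) where
    open Is3Preorder ⊑-is3Preorder

    ⊑⇔≼ˢ : ∀ {y x} → inj₂ y ⊑ inj₁ x ⇔ y ≼ˢ x
    ⊑⇔≼ˢ {y} {x} = mk⇔
      (λ y⊑x p x≤eXp → ιY-emb y (eY p) (trans≼ (trans≼ y⊑x (≤X⊆ x≤eXp)) (e-eq₁ p)))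
      (λ y≼x → proj₂ (meets (λ p → x X.≤ eX p) x (meetExt x)) (inj₂ y)
                 (λ p x≤eXp → trans≼ (≤Y⊆ (y≼x p x≤eXp)) (e-eq₂ p)))

    ⊑⇔≼ : ∀ z w → z ⊑ w ⇔ z ≼ w
    ⊑⇔≼ (inj₁ x) (inj₁ x′) = mk⇔ (lift ∘ ιX-emb x x′) (≤X⊆ ∘ lower)
    ⊑⇔≼ (inj₂ y) (inj₂ y′) = mk⇔ (lift ∘ ιY-emb y y′) (≤Y⊆ ∘ lower)
    ⊑⇔≼ (inj₁ x) (inj₂ y)  = mk⇔ (lift ∘ Equivalence.to (R⇔ x y)) (Equivalence.from (R⇔ x y) ∘ lower)
    ⊑⇔≼ (inj₂ y) (inj₁ x)  = ⇔-sym (mk⇔ ≼₃⇒≼ˢ ≼ˢ⇒≼₃) ⇔-∘ ⊑⇔≼ˢ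

  ιX-join-dense : ∀ z → Σ (Pred X.Carrier 0ℓ) λ A → Join _≼_ A inj₁ z
  ιX-join-dense (inj₁ x) = (X._≤ x) , (λ _ a≤x → lift a≤x) , (λ _ A≼u → A≼u x X.refl)
  ιX-join-dense (inj₂ y) = (λ a → R a y) , (λ _ aRy → lift aRy) , least
    where
    least : ∀ u → (∀ a → R a y → inj₁ a ≼ u) → inj₂ y ≼ u
    least u A≼u = proj₂ (ιY-preserves-joins (λ q → eY q Y.≤ y) eY y (joinExt y)) u
      (λ q eYq≤y → ≼-trans {inj₂ (eY q)} {inj₁ (eX q)} {u} (eY≼eX q) (A≼u (eX q) (C2 eYq≤y (C3 q))))

  ιY-meet-dense : ∀ z → Σ (Pred Y.Carrier 0ℓ) λ B → Meet _≼_ B inj₂ z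
  ιY-meet-dense (inj₂ y) = (y Y.≤_) , (λ _ y≤b → lift y≤b) , (λ _ l≼B → l≼B y Y.refl)
  ιY-meet-dense (inj₁ x) = (R x) , (λ _ xRb → lift xRb) , greatest
    where
    greatest : ∀ l → (∀ b → R x b → l ≼ inj₂ b) → l ≼ inj₁ x
    greatest l l≼B = proj₂ (ιX-preserves-meets (λ p → x X.≤ eX p) eX x (meetExt x)) l
      (λ p x≤eXp → ≼-trans {l} {inj₂ (eY p)} {inj₁ (eX p)} (l≼B (eY p) (C1 x≤eXp (C3 p))) (eY≼eX p))

theorem4p12 : (G : ExtensionPolarity) → IsGaloisPolarity G →
    let open ExtensionPolarity G in
    -- (1) ιX completely meet-preserving, ιY completely join-preserving
    ((∀ (A : Pred X.Carrier 0ℓ) m → Meet X._≤_ A (λ x → x) m →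
        Meet (_≼₃_ G) A (ιX G) (ιX G m))
     × (∀ (B : Pred Y.Carrier 0ℓ) m → Join Y._≤_ B (λ y → y) m →
        Join (_≼₃_ G) B (ιY G) (ιY G m)))
    -- (2) ≼₃ is a 3-preorder, and it is the only one
    × (Is3Preorder G (_≼₃_ G)
       × (∀ (_≼_ : Z G → Z G → Set₁) → Is3Preorder G _≼_ →
          ∀ z w → (z ≼ w ⇔ _≼₃_ G z w)))
    -- (3) join-generated by ιX[X], meet-generated by ιY[Y]
    × ((∀ z → Σ (Pred X.Carrier 0ℓ) λ A → Join (_≼₃_ G) A (ιX G) z)
       × (∀ z → Σ (Pred Y.Carrier 0ℓ) λ B → Meet (_≼₃_ G) B (ιY G) z))
theorem4p12 G gal =
    ((λ A → ιX-preserves-meets A id) , (λ B → ιY-preserves-joins B id))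
  , (≼-is3Preorder , λ _ ⊑-is3Preorder → ⊑⇔≼ ⊑-is3Preorder)
  , (ιX-join-dense , ιY-meet-dense)
  where open GaloisPolarity G gal
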